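{- There exist a database $D$ and a temporal linear, union-free DatalogMTL program $\Pi$ that only uses temporal operators $\Diamond^-_{\langle t_1,t_2\rangle}$ and $\boxminus_{\langle t_1,t_2\rangle}$, each with $t_2>t_1$, such that there is no time point $T\in\mathbb Q$ with the property that for every $t>T$ and every ground atom $\alpha$: $\alpha@t\in\Pi(D)$ iff $\alpha@T\in\Pi(D)$.
   Context: DatalogMTL over $\mathbb Q$ with continuous semantics. Rules are of the forms $P_1(\boldsymbol\tau_1)\land\dots\land P_n(\boldsymbol\tau_n)\to P_0(\boldsymbol\tau_0)$, $\Diamond^-_\varrho P_1(\boldsymbol\tau_1)\to P_0(\boldsymbol\tau_0)$, $\boxminus_\varrho P_1(\boldsymbol\tau_1)\to P_0(\boldsymbol\tau_0)$ with non-negative intervals $\varrho$; $\mathfrak M,t\models\Diamond^-_\varrho A$ iff $A$ holds at some $s$ with $t-s\in\varrho$, and $\mathfrak M,t\models\boxminus_\varrho A$ iff $A$ holds at all $s$ with $t-s\in\varrho$. A database is a finite set of facts $A@\varrho$; $\Pi(D)$ is the minimum model, and $\alpha@t\in\Pi(D)$ means $\alpha$ holds at $t$ there. A program is union-free if each atom occurs at most once in the heads of all rules. Dependency graph: vertices are predicates, an edge $(P,Q)$ for each rule with $P$ in body and $Q$ in head, special if the rule has a temporal operator. Two predicates are temporal mutually recursive if they lie on a common cycle containing a special edge. A rule is temporal linear if at most one body predicate is temporal mutually recursive with its head; a program is temporal linear if all its rules are. -}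

module Defs where

open import Data.Nat using (ℕ)
open import Data.Bool using (Bool; true; false)
open import Data.List using (List; []; _∷_; map; zip; _++_; [_])
open import Data.List.Membership.Propositional using (_∈_)
open import Data.List.Relation.Unary.Any using (Any)
open import Data.List.Relation.Unary.All using (All)
open import Data.List.Relation.Unary.Unique.Propositional using (Unique)
open import Data.Product using (Σ; ∃; _×_; _,_)
open import Data.Sum using (_⊎_)
open import Data.Unit using (⊤)
open import Data.Empty using (⊥)
open import Level using (Level; suc; zero)
open import Relation.Binary.PropositionalEquality using (_≡_)
open import Data.Rational using (ℚ; 0ℚ; _≤_; _<_; _-_)

Pred  = ℕ
Const = ℕ
Var   = ℕ

data Term : Set where
  var : Var → Term
  con : Const → Term

record Atom : Set where
  constructor atom
  field
    pred : Pred
    args : List Term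

record GAtom : Set where
  constructor gatom
  field
    gpred : Pred
    gargs : List Const

-- interval bounds over ℚ ∪ {±∞}; cl = closed bracket, op = open bracket
data LBound : Set where
  -∞   : LBound
  cl op : ℚ → LBound

data UBound : Set where
  +∞   : UBound
  cl op : ℚ → UBound

record Interval : Set where
  constructor ⟨_,_⟩
  field
    lower : LBound
    upper : UBound

_∈ᵢ_ : ℚ → Interval → Set
t ∈ᵢ ⟨ l , u ⟩ = aboveL l × belowU u
  where
  aboveL : LBound → Set
  aboveL -∞     = ⊤
  aboveL (cl q) = q ≤ t
  aboveL (op q) = q < t
  belowU : UBound → Set
  belowU +∞     = ⊤
  belowU (cl q) = t ≤ q
  belowU (op q) = t < q

NonNegative : Interval → Set
NonNegative ⟨ -∞ , u ⟩   = ⊥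
NonNegative ⟨ cl q , u ⟩ = 0ℚ ≤ q
NonNegative ⟨ op q , u ⟩ = 0ℚ ≤ q

-- rules:  P₁ ∧ … ∧ Pₙ → P₀  (n ≥ 1),  ◇⁻_ϱ P₁ → P₀,  ⊟_ϱ P₁ → P₀
data Rule : Set where
  conj : (body₁ : Atom) (bodyRest : List Atom) (head : Atom) → Rule
  dia  : (ϱ : Interval) (body : Atom) (head : Atom) → Rule
  box  : (ϱ : Interval) (body : Atom) (head : Atom) → Rule

Program  = List Rule

Fact     = GAtom × Interval
Database = List Fact

headOf : Rule → Atom
headOf (conj _ _ h) = h
headOf (dia _ _ h)  = h
headOf (box _ _ h)  = h

bodyAtoms : Rule → List Atom
bodyAtoms (conj b bs _) = b ∷ bs
bodyAtoms (dia _ b _)   = b ∷ []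
bodyAtoms (box _ b _)   = b ∷ []

isTemporal : Rule → Bool
isTemporal (conj _ _ _) = false
isTemporal (dia _ _ _)  = true
isTemporal (box _ _ _)  = true

WellFormedRule : Rule → Set
WellFormedRule (conj _ _ _) = ⊤
WellFormedRule (dia ϱ _ _)  = NonNegative ϱ
WellFormedRule (box ϱ _ _)  = NonNegative ϱ

WellFormed : Program → Set
WellFormed Π = All WellFormedRule Π

Interpretation : Set₁
Interpretation = GAtom → ℚ → Set

Subst = Var → Const

groundT : Subst → Term → Const
groundT σ (var x) = σ x
groundT σ (con c) = c

ground : Subst → Atom → GAtom
ground σ (atom P ts) = gatom P (map (groundT σ) ts)

DiamondMinus : Interpretation → Interval → GAtom → ℚ → Set
DiamondMinus M ϱ α t = Σ ℚ λ s → ((t - s) ∈ᵢ ϱ) × M α s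

BoxMinus : Interpretation → Interval → GAtom → ℚ → Set
BoxMinus M ϱ α t = (s : ℚ) → (t - s) ∈ᵢ ϱ → M α s

SatRule : Interpretation → Rule → Set
SatRule M (conj b bs h) = (σ : Subst) (t : ℚ) →
  All (λ A → M (ground σ A) t) (b ∷ bs) → M (ground σ h) t
SatRule M (dia ϱ b h) = (σ : Subst) (t : ℚ) →
  DiamondMinus M ϱ (ground σ b) t → M (ground σ h) t
SatRule M (box ϱ b h) = (σ : Subst) (t : ℚ) →
  BoxMinus M ϱ (ground σ b) t → M (ground σ h) t

SatFact : Interpretation → Fact → Set
SatFact M (α , ϱ) = (t : ℚ) → t ∈ᵢ ϱ → M α t

IsModel : Program → Database → Interpretation → Set
IsModel Π D M = All (SatRule M) Π × All (SatFact M) D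

-- α@t ∈ Π(D): α holds at t in the minimum model of Π and D, i.e. in
-- every model of Π and D (the minimum model is their intersection)
_at_∈⟦_,_⟧ : GAtom → ℚ → Program → Database → Set₁
α at t ∈⟦ Π , D ⟧ = (M : Interpretation) → IsModel Π D M → M α t

UnionFree : Program → Set
UnionFree Π = Unique (map headOf Π)

-- dependency graph: edge (P , Q) for a rule with P in body and Q in head;
-- the Bool records whether it is special (the rule has a temporal operator)
Edge : Program → Bool → Pred → Pred → Set
Edge Π b P Q = Σ Rule λ r → r ∈ Π × (P ∈ map Atom.pred (bodyAtoms r))
  × (Q ≡ Atom.pred (headOf r)) × (b ≡ isTemporal r)

cyclePairs : List Pred → List (Pred × Pred)
cyclePairs []       = []
cyclePairs (v ∷ vs) = zip (v ∷ vs) (vs ++ [ v ])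

record SpecialCycle (Π : Program) (vs : List Pred) : Set where
  field
    nonEmpty  : Σ Pred λ v → Σ (List Pred) λ ws → vs ≡ v ∷ ws
    simple    : Unique vs
    edges     : All (λ { (P , Q) → Σ Bool λ b → Edge Π b P Q }) (cyclePairs vs)
    special   : Any (λ { (P , Q) → Edge Π true P Q }) (cyclePairs vs)

TMR : Program → Pred → Pred → Set
TMR Π P Q = Σ (List Pred) λ vs → SpecialCycle Π vs × P ∈ vs × Q ∈ vs

TemporalLinearRule : Program → Rule → Set
TemporalLinearRule Π r = (P P′ : Pred) →
  P ∈ map Atom.pred (bodyAtoms r) → TMR Π P (Atom.pred (headOf r)) →
  P′ ∈ map Atom.pred (bodyAtoms r) → TMR Π P′ (Atom.pred (headOf r)) →
  P ≡ P′

TemporalLinear : Program → Set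
TemporalLinear Π = All (TemporalLinearRule Π) Π

UpperAbove : ℚ → UBound → Set
UpperAbove t₁ +∞     = ⊤
UpperAbove t₁ (cl q) = t₁ < q
UpperAbove t₁ (op q) = t₁ < q

ProperInterval : Interval → Set
ProperInterval ⟨ -∞ , u ⟩   = ⊥
ProperInterval ⟨ cl q , u ⟩ = (0ℚ ≤ q) × UpperAbove q u
ProperInterval ⟨ op q , u ⟩ = (0ℚ ≤ q) × UpperAbove q u

ProperOpsRule : Rule → Set
ProperOpsRule (conj _ _ _) = ⊤
ProperOpsRule (dia ϱ _ _)  = ProperInterval ϱ
ProperOpsRule (box ϱ _ _)  = ProperInterval ϱ

ProperOps : Program → Set
ProperOps Π = All ProperOpsRule Π

{-# OPTIONS --safe #-}
module Submission where

-- Take the program  ⊟_[0,½] Q → P,  ◇⁻_[½,1] P → Q  and the database {P@[0,0]}.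
-- By induction P is entailed at every natural number n: Q then holds on
-- [n+½, n+1], hence P at n+1.  Conversely, making P true exactly at the
-- integers and Q exactly where ◇⁻_[½,1] P holds (on the intervals [k+½, k+1])
-- gives a model, so P is not entailed at n+½.  If Π(D) were constant after T,
-- then P would hold at T (via a natural number N > T) and so at N+½.

open import Defs
open import Data.Product using (Σ; ∃; _×_; _,_)
open import Data.Rational using (ℚ; mkℚ; _<_; _≤_; _+_; _-_; -_; 0ℚ; 1ℚ; ½; *<*; *≤*; _<?_)
open import Data.Rational.Literals using (fromℤ)
open import Data.Rational.Properties
import Data.Rational.Unnormalised as ℚᵘ
import Data.Rational.Unnormalised.Properties as ℚᵘ
open import Data.Rational.Solver using (module +-*-Solver)
open import Data.Integer as ℤ using (ℤ; +_; -[1+_])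
import Data.Integer.Properties as ℤ
import Data.Integer.Solver as ℤ-Solver
open import Data.Nat as ℕ using (zero; suc; z≤n; s≤s)
import Data.Nat.Properties as ℕ
open import Data.List using ([]; _∷_; [_])
open import Data.List.Membership.Propositional using (_∈_)
open import Data.List.Relation.Unary.All using (_∷_; [])
open import Data.List.Relation.Unary.AllPairs using (_∷_; [])
open import Data.List.Relation.Unary.Any.Properties using (singleton⁻)
open import Data.Empty using (⊥; ⊥-elim)
open import Relation.Nullary using (¬_; yes; no)
open import Relation.Binary.PropositionalEquality using (_≡_; refl; sym; trans; cong; subst; subst₂; module ≡-Reasoning)
open import Function.Bundles using (_⇔_; Equivalence)

fromℤ-homo-+ : ∀ i j → fromℤ (i ℤ.+ j) ≡ fromℤ i + fromℤ j
fromℤ-homo-+ i j = toℚᵘ-injective (ℚᵘ.≃-sym (ℚᵘ.≃-trans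
  (toℚᵘ-homo-+ (fromℤ i) (fromℤ j))
  (ℚᵘ.*≡* (solve 2 (λ i j → (i :* con (+ 1) :+ j :* con (+ 1)) :* con (+ 1) := (i :+ j) :* con (+ 1)) refl i j))))
  where open ℤ-Solver.+-*-Solver

fromℤ-homo‿- : ∀ i → fromℤ (ℤ.- i) ≡ - fromℤ i
fromℤ-homo‿- (+ zero)  = refl
fromℤ-homo‿- (+ suc n) = refl
fromℤ-homo‿- -[1+ n ]  = refl

fromℤ-homo-- : ∀ i j → fromℤ (i ℤ.- j) ≡ fromℤ i - fromℤ j
fromℤ-homo-- i j = trans (fromℤ-homo-+ i (ℤ.- j)) (cong (_+_ (fromℤ i)) (fromℤ-homo‿- j))

fromℤ-cancel-< : ∀ {i j} → fromℤ i < fromℤ j → i ℤ.< j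
fromℤ-cancel-< {i} {j} (*<* i<j) = subst₂ ℤ._<_ (ℤ.*-identityʳ i) (ℤ.*-identityʳ j) i<j

fromℤ∉⟨0,1⟩ : ∀ i → 0ℚ < fromℤ i → fromℤ i < 1ℚ → ⊥
fromℤ∉⟨0,1⟩ i 0<i i<1 = ℤ.<⇒≱ (fromℤ-cancel-< i<1) (ℤ.i<j⇒suc[i]≤j (fromℤ-cancel-< 0<i))

archimedean : ∀ p → ∃ λ n → p < fromℤ (+ n)
archimedean (mkℚ i d-1 _) = suc ℤ.∣ i ∣ , *<* (begin-strict
  i ℤ.* + 1                    ≡⟨ ℤ.*-identityʳ i ⟩
  i                            ≤⟨ i≤∣i∣ i ⟩
  + ℤ.∣ i ∣                    <⟨ ℤ.+<+ ℕ.≤-refl ⟩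
  + suc ℤ.∣ i ∣                ≤⟨ ℤ.+≤+ (ℕ.m≤m*n (suc ℤ.∣ i ∣) (suc d-1)) ⟩
  + suc ℤ.∣ i ∣ ℤ.* + suc d-1  ∎)
  where
  open ℤ.≤-Reasoning
  i≤∣i∣ : ∀ i → i ℤ.≤ + ℤ.∣ i ∣
  i≤∣i∣ (+ n)    = ℤ.≤-refl
  i≤∣i∣ -[1+ n ] = ℤ.-≤+

sub-mono-≤ : ∀ {p q r s} → p ≤ q → r ≤ s → p - s ≤ q - r
sub-mono-≤ p≤q r≤s = +-mono-≤ p≤q (neg-antimono-≤ r≤s)

sub-mono-<-≤ : ∀ {p q r s} → p < q → r ≤ s → p - s < q - r
sub-mono-<-≤ p<q r≤s = +-mono-<-≤ p<q (neg-antimono-≤ r≤s)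

sub-mono-≤-< : ∀ {p q r s} → p ≤ q → r < s → p - s < q - r
sub-mono-≤-< p≤q r<s = +-mono-≤-< p≤q (neg-antimono-< r<s)

0≤½ : 0ℚ ≤ ½
0≤½ = *≤* (ℤ.+≤+ z≤n)

0<½ : 0ℚ < ½
0<½ = *<* (ℤ.+<+ (s≤s z≤n))

½<1 : ½ < 1ℚ
½<1 = *<* (ℤ.+<+ (s≤s (s≤s z≤n)))

ϱ⊟ ϱ◇ : Interval
ϱ⊟ = ⟨ cl 0ℚ , cl ½ ⟩
ϱ◇ = ⟨ cl ½ , cl 1ℚ ⟩

P Q : Atom
P = atom 0 []
Q = atom 1 []

p : GAtom
p = gatom 0 []

Π₀ : Program
Π₀ = box ϱ⊟ Q P ∷ dia ϱ◇ P Q ∷ []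

D₀ : Database
D₀ = (p , ⟨ cl 0ℚ , cl 0ℚ ⟩) ∷ []

Π₀-wellFormed : WellFormed Π₀
Π₀-wellFormed = ≤-refl ∷ 0≤½ ∷ []

Π₀-properOps : ProperOps Π₀
Π₀-properOps = (≤-refl , 0<½) ∷ (0≤½ , ½<1) ∷ []

Π₀-unionFree : UnionFree Π₀
Π₀-unionFree = ((λ ()) ∷ []) ∷ [] ∷ []

∈-[x]-unique : ∀ {x y z : Pred} → y ∈ [ x ] → z ∈ [ x ] → y ≡ z
∈-[x]-unique y∈ z∈ = trans (singleton⁻ y∈) (sym (singleton⁻ z∈))

Π₀-temporalLinear : TemporalLinear Π₀
Π₀-temporalLinear = (λ _ _ y∈ _ z∈ _ → ∈-[x]-unique y∈ z∈) ∷ (λ _ _ y∈ _ z∈ _ → ∈-[x]-unique y∈ z∈) ∷ []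

p-at-naturals : ∀ n → p at fromℤ (+ n) ∈⟦ Π₀ , D₀ ⟧
p-at-naturals zero    M (_ , fact ∷ [])                      = fact 0ℚ (≤-refl , ≤-refl)
p-at-naturals (suc n) M model@((⊟-rule ∷ ◇-rule ∷ []) , _) =
  subst (M p) (sym (fromℤ-homo-+ (+ 1) (+ n)))
    (⊟-rule σ (1ℚ + m) λ s w → ◇-rule σ s (m , ⊟-to-◇ s w , p-at-naturals n M model))
  where
  σ : Subst
  σ _ = 0
  m : ℚ
  m = fromℤ (+ n)
  ⊟-to-◇ : ∀ s → (1ℚ + m - s) ∈ᵢ ϱ⊟ → (s - m) ∈ᵢ ϱ◇
  ⊟-to-◇ s (0≤d , d≤½) = subst (_∈ᵢ ϱ◇) (sym s-m≡1-d) (sub-mono-≤ ≤-refl d≤½ , sub-mono-≤ ≤-refl 0≤d)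
    where
    open +-*-Solver
    s-m≡1-d : s - m ≡ 1ℚ - (1ℚ + m - s)
    s-m≡1-d = solve 2 (λ s m → s :- m := con 1ℚ :- (con 1ℚ :+ m :- s)) refl s m

IsInteger : ℚ → Set
IsInteger s = ∃ λ k → s ≡ fromℤ k

◇Integer : ℚ → Set
◇Integer t = Σ ℚ λ s → (t - s) ∈ᵢ ϱ◇ × IsInteger s

integerModel : Interpretation
integerModel (gatom 1 _) = ◇Integer
integerModel (gatom _ _) = IsInteger

◇Integer-gap : ∀ k {e} → 0ℚ < e → e < ½ → ¬ ◇Integer (fromℤ k + e)
◇Integer-gap k {e} 0<e e<½ (_ , (½≤s-j , s-j≤1) , j , refl) =
  fromℤ∉⟨0,1⟩ (k ℤ.- j)
    (subst (0ℚ <_) (sym k-j≡s-j-e) (sub-mono-≤-< ½≤s-j e<½))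
    (subst (_< 1ℚ) (sym k-j≡s-j-e) (sub-mono-≤-< s-j≤1 0<e))
  where
  open ≡-Reasoning
  open +-*-Solver
  k-j≡s-j-e : fromℤ (k ℤ.- j) ≡ fromℤ k + e - fromℤ j - e
  k-j≡s-j-e = begin
    fromℤ (k ℤ.- j)             ≡⟨ fromℤ-homo-- k j ⟩
    fromℤ k - fromℤ j           ≡⟨ solve 3 (λ k j e → k :- j := k :+ e :- j :- e) refl (fromℤ k) (fromℤ j) e ⟩
    fromℤ k + e - fromℤ j - e   ∎

⊟-window-point : ∀ {d} → ½ ≤ d → d < 1ℚ → ∃ λ e → 0ℚ < e × e < ½ × (d - e) ∈ᵢ ϱ⊟
⊟-window-point {d} ½≤d d<1 with <-dense (sub-mono-<-≤ d<1 (≤-refl {½}))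
... | e , d-½<e , e<½ = e , 0<e , e<½ , 0≤d-e , d-e≤½
  where
  open +-*-Solver
  0<e : 0ℚ < e
  0<e = ≤-<-trans (sub-mono-≤ ½≤d (≤-refl {½})) d-½<e
  0≤d-e : 0ℚ ≤ d - e
  0≤d-e = subst (_≤ d - e) (+-inverseʳ e) (sub-mono-≤ (<⇒≤ (<-≤-trans e<½ ½≤d)) (≤-refl {e}))
  d-e≤½ : d - e ≤ ½
  d-e≤½ = subst (d - e ≤_) (solve 1 (λ d → d :- (d :- con ½) := con ½) refl d) (sub-mono-≤ (≤-refl {d}) (<⇒≤ d-½<e))

-- Q at t gives t ∈ [k+½, k+1]; if t < k+1, then [t-½, t] meets the gap (k, k+½).
⊟◇Integer⇒IsInteger : ∀ t → (∀ s → (t - s) ∈ᵢ ϱ⊟ → ◇Integer s) → IsInteger t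
⊟◇Integer⇒IsInteger t ⊟◇ with ⊟◇ t (subst (_∈ᵢ ϱ⊟) (sym (+-inverseʳ t)) (≤-refl , 0≤½))
... | _ , (½≤d , d≤1) , k , refl with t - fromℤ k <? 1ℚ
...   | yes d<1 with ⊟-window-point ½≤d d<1
...     | e , 0<e , e<½ , d-e∈ϱ⊟ =
  ⊥-elim (◇Integer-gap k 0<e e<½ (⊟◇ (fromℤ k + e) (subst (_∈ᵢ ϱ⊟) d-e≡t-s d-e∈ϱ⊟)))
  where
  open +-*-Solver
  d-e≡t-s : t - fromℤ k - e ≡ t - (fromℤ k + e)
  d-e≡t-s = solve 3 (λ t k e → t :- k :- e := t :- (k :+ e)) refl t (fromℤ k) e
⊟◇Integer⇒IsInteger t ⊟◇ | _ , (½≤d , d≤1) , k , refl | no d≮1 = k ℤ.+ + 1 , (begin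
  t                        ≡⟨ solve 2 (λ t k → t := k :+ (t :- k)) refl t (fromℤ k) ⟩
  fromℤ k + (t - fromℤ k)  ≡⟨ cong (_+_ (fromℤ k)) (≤-antisym d≤1 (≮⇒≥ d≮1)) ⟩
  fromℤ k + 1ℚ             ≡⟨ fromℤ-homo-+ k (+ 1) ⟨
  fromℤ (k ℤ.+ + 1)        ∎)
  where
  open ≡-Reasoning
  open +-*-Solver

integerModel-isModel : IsModel Π₀ D₀ integerModel
integerModel-isModel =
  ((λ _ → ⊟◇Integer⇒IsInteger) ∷ (λ _ _ ◇ → ◇) ∷ []) ,
  ((λ _ (0≤t , t≤0) → + 0 , ≤-antisym t≤0 0≤t) ∷ [])

p-not-at-half-integers : ∀ k → ¬ (p at fromℤ k + ½ ∈⟦ Π₀ , D₀ ⟧)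
p-not-at-half-integers k p-at-k+½ with p-at-k+½ integerModel integerModel-isModel
... | j , k+½≡j = fromℤ∉⟨0,1⟩ (j ℤ.- k) (subst (0ℚ <_) (sym j-k≡½) 0<½) (subst (_< 1ℚ) (sym j-k≡½) ½<1)
  where
  open ≡-Reasoning
  open +-*-Solver
  j-k≡½ : fromℤ (j ℤ.- k) ≡ ½
  j-k≡½ = begin
    fromℤ (j ℤ.- k)          ≡⟨ fromℤ-homo-- j k ⟩
    fromℤ j - fromℤ k        ≡⟨ cong (_- fromℤ k) k+½≡j ⟨
    fromℤ k + ½ - fromℤ k    ≡⟨ solve 1 (λ k → k :+ con ½ :- k := con ½) refl (fromℤ k) ⟩
    ½                        ∎

p-holds-unboundedly : ∀ T → ∃ λ t → T < t × p at t ∈⟦ Π₀ , D₀ ⟧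
p-holds-unboundedly T = let N , T<N = archimedean T in fromℤ (+ N) , T<N , p-at-naturals N

p-fails-unboundedly : ∀ T → ∃ λ t → T < t × ¬ (p at t ∈⟦ Π₀ , D₀ ⟧)
p-fails-unboundedly T =
  let N , T<N = archimedean T
  in  fromℤ (+ N) + ½ , <-≤-trans T<N (p≤p+½ (fromℤ (+ N))) , p-not-at-half-integers (+ N)
  where
  p≤p+½ : ∀ q → q ≤ q + ½
  p≤p+½ q = subst (_≤ q + ½) (+-identityʳ q) (+-monoʳ-≤ q 0≤½)

not-eventually-constant : ∀ {Π D} α →
  (∀ T → ∃ λ t → T < t × α at t ∈⟦ Π , D ⟧) →
  (∀ T → ∃ λ t → T < t × ¬ (α at t ∈⟦ Π , D ⟧)) →
  ¬ (Σ ℚ λ T → (t : ℚ) → T < t → (β : GAtom) → ((β at t ∈⟦ Π , D ⟧) ⇔ (β at T ∈⟦ Π , D ⟧)))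
not-eventually-constant α holds fails (T , constant) =
  let t  , T<t  , α-at-t   = holds T
      t′ , T<t′ , ¬α-at-t′ = fails T
  in  ¬α-at-t′ (Equivalence.from (constant t′ T<t′ α) (Equivalence.to (constant t T<t α) α-at-t))

proposition4 : Σ Database λ D → Σ Program λ Π →
    WellFormed Π × TemporalLinear Π × UnionFree Π × ProperOps Π ×
    ¬ (Σ ℚ λ T → (t : ℚ) → T < t → (α : GAtom) →
         ((α at t ∈⟦ Π , D ⟧) ⇔ (α at T ∈⟦ Π , D ⟧)))
proposition4 =
  D₀ , Π₀ , Π₀-wellFormed , Π₀-temporalLinear , Π₀-unionFree , Π₀-properOps ,
  not-eventually-constant p p-holds-unboundedly p-fails-unboundedly
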